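{- Let $\mathcal{GO}=\langle t,\prec,\phi\rangle$ be a GOMT problem with $\phi$ satisfiable, and let $\langle\mathcal{I},\Delta,\tau\rangle$ be a state in a $\mathcal{GO}$-derivation with $\tau=\emptyset$. Then $\phi\models_{\mathcal{T}}\neg\Delta$.
   Context: Fix a many-sorted first-order theory $\mathcal{T}$ with signature $\Sigma$; interpretations are $\mathcal{T}$-interpretations assigning values to all variables, and $\models$ means $\models_{\mathcal{T}}$. A GOMT problem is $\mathcal{GO}=\langle t,\prec,\phi\rangle$: $t$ a $\Sigma$-term of sort $\sigma$, $\prec$ a strict partial order on values of sort $\sigma$ definable in $\mathcal{T}$, $\phi$ a $\Sigma$-formula. $\mathcal{I}$ is $\mathcal{GO}$-consistent if $\mathcal{I}\models\phi$; $\mathcal{I}<_{\mathcal{GO}}\mathcal{I}'$ if both are $\mathcal{GO}$-consistent and $t^{\mathcal{I}}\prec t^{\mathcal{I}'}$. $\textsc{Solve}$ maps a formula to an interpretation satisfying it if satisfiable, else to $\bot$. $\textsc{Better}$ maps each $\mathcal{GO}$-consistent $\mathcal{I}$ to a formula with: for every $\mathcal{GO}$-consistent $\mathcal{I}'$, $\mathcal{I}'\models\textsc{Better}(\mathcal{I})$ iff $\mathcal{I}'<_{\mathcal{GO}}\mathcal{I}$. $\textsc{Top}(s_1,\dots,s_n)=s_1$, $\textsc{Pop}(s_1,\dots,s_n)=(s_2,\dots,s_n)$, $\emptyset$ the empty sequence, $\circ$ concatenation. A state is $\langle\mathcal{I},\Delta,\tau\rangle$ (interpretation, formula, finite sequence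 of formulas). Initial state: $\mathcal{I}_0=\textsc{Solve}(\phi)$, $\Delta_0=\textsc{Better}(\mathcal{I}_0)$, $\tau_0=(\Delta_0)$. Rules (unmentioned components unchanged): F-Split: if $\tau\neq\emptyset$, $\psi=\textsc{Top}(\tau)$, $\phi\models\psi\Leftrightarrow\bigvee_{j=1}^k\psi_j$, $k\ge1$, then $\tau:=(\psi_1,\dots,\psi_k)\circ\textsc{Pop}(\tau)$. F-Sat: if $\tau\neq\emptyset$, $\psi=\textsc{Top}(\tau)$, $\textsc{Solve}(\phi\wedge\psi)=\mathcal{I}'\neq\bot$, $\Delta'=\Delta\wedge\textsc{Better}(\mathcal{I}')$, then $\mathcal{I}:=\mathcal{I}'$, $\Delta:=\Delta'$, $\tau:=(\Delta')$. F-Close: if $\tau\neq\emptyset$, $\psi=\textsc{Top}(\tau)$, $\textsc{Solve}(\phi\wedge\psi)=\bot$, then $\Delta:=\Delta\wedge\neg\psi$, $\tau:=\textsc{Pop}(\tau)$. A rule applies if its premises hold and the resulting state differs. A $\mathcal{GO}$-derivation is a sequence of states starting at the initial state, each obtained from the previous by one rule. -}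

module Defs where

open import Data.Product using (Σ; ∃; _×_; _,_)
open import Data.Sum using (_⊎_)
open import Data.Maybe using (Maybe; just; nothing)
open import Data.List using (List; []; _∷_; _++_)
open import Data.List.NonEmpty using (List⁺; _∷_; toList)
open import Relation.Nullary using (¬_)
open import Relation.Binary.PropositionalEquality using (_≡_; _≢_)
open import Relation.Binary.Structures using (IsStrictPartialOrder)
open import Function.Bundles using (_⇔_)

-- A (fixed) first-order theory T, presented semantically:
--   Interp : the T-interpretations (assigning values to all variables),
--   Form   : Σ-formulas, with the connectives used by the calculus,
--   _⊨_    : satisfaction  I ⊨_T ψ.
record Theory : Set₁ where
  infix 4 _⊨_
  infixr 6 _∧_
  infixr 5 _∨_
  field
    Interp : Set
    Form   : Set
    _⊨_    : Interp → Form → Set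
    _∧_    : Form → Form → Form
    _∨_    : Form → Form → Form
    ¬ᶠ_    : Form → Form
    ⊨-∧    : ∀ I ψ χ → (I ⊨ ψ ∧ χ) ⇔ (I ⊨ ψ × I ⊨ χ)
    ⊨-∨    : ∀ I ψ χ → (I ⊨ ψ ∨ χ) ⇔ ((I ⊨ ψ) ⊎ (I ⊨ χ))
    ⊨-¬    : ∀ I ψ → (I ⊨ ¬ᶠ ψ) ⇔ (¬ (I ⊨ ψ))

  ⋁′ : Form → List Form → Form
  ⋁′ ψ []       = ψ
  ⋁′ ψ (χ ∷ χs) = ψ ∨ ⋁′ χ χs

  ⋁ : List⁺ Form → Form
  ⋁ (ψ ∷ ψs) = ⋁′ ψ ψs

  _⊨ᵀ_ : Form → Form → Set
  φ ⊨ᵀ ψ = ∀ I → I ⊨ φ → I ⊨ ψ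

  _⊨ᵀ_⟺_ : Form → Form → Form → Set
  φ ⊨ᵀ ψ ⟺ χ = ∀ I → I ⊨ φ → (I ⊨ ψ) ⇔ (I ⊨ χ)

  Satisfiable : Form → Set
  Satisfiable ψ = ∃ λ I → I ⊨ ψ

-- A GOMT problem ⟨t, ≺, φ⟩ over T: the term t is given by its value
-- function I ↦ t^I into the values V of its sort σ; ≺ is a strict
-- partial order on V.
record GOMT (T : Theory) : Set₁ where
  open Theory T
  field
    V     : Set
    t     : Interp → V
    _≺_   : V → V → Set
    ≺-spo : IsStrictPartialOrder _≡_ _≺_
    φ     : Form

  Consistent : Interp → Set
  Consistent I = I ⊨ φ

  _<GO_ : Interp → Interp → Set
  I <GO I' = Consistent I × Consistent I' × (t I ≺ t I')

record Oracles {T : Theory} (GO : GOMT T) : Set₁ where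
  open Theory T
  open GOMT GO
  field
    Solve     : Form → Maybe Interp
    Solve-sat : ∀ ψ I → Solve ψ ≡ just I → I ⊨ ψ
    Solve-bot : ∀ ψ → Solve ψ ≡ nothing → ¬ Satisfiable ψ
    Better    : Interp → Form
    Better-spec : ∀ I I' → Consistent I → Consistent I' →
                  (I' ⊨ Better I) ⇔ (I' <GO I)

module Calculus {T : Theory} (GO : GOMT T) (O : Oracles GO) where
  open Theory T
  open GOMT GO
  open Oracles O

  record State : Set where
    constructor ⟨_,_,_⟩
    field
      I : Interp
      Δ : Form
      τ : List Form
  open State public

  data _⟶_ : State → State → Set where
    F-Split : ∀ {I Δ ψ τ} (ψs : List⁺ Form) →
              φ ⊨ᵀ ψ ⟺ ⋁ ψs →
              ⟨ I , Δ , toList ψs ++ τ ⟩ ≢ ⟨ I , Δ , ψ ∷ τ ⟩ →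
              ⟨ I , Δ , ψ ∷ τ ⟩ ⟶ ⟨ I , Δ , toList ψs ++ τ ⟩
    F-Sat   : ∀ {I Δ ψ τ I'} →
              Solve (φ ∧ ψ) ≡ just I' →
              ⟨ I' , Δ ∧ Better I' , (Δ ∧ Better I') ∷ [] ⟩ ≢ ⟨ I , Δ , ψ ∷ τ ⟩ →
              ⟨ I , Δ , ψ ∷ τ ⟩ ⟶ ⟨ I' , Δ ∧ Better I' , (Δ ∧ Better I') ∷ [] ⟩
    F-Close : ∀ {I Δ ψ τ} →
              Solve (φ ∧ ψ) ≡ nothing →
              ⟨ I , Δ ∧ ¬ᶠ ψ , τ ⟩ ≢ ⟨ I , Δ , ψ ∷ τ ⟩ →
              ⟨ I , Δ , ψ ∷ τ ⟩ ⟶ ⟨ I , Δ ∧ ¬ᶠ ψ , τ ⟩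

  data InDerivation : State → Set where
    initial : ∀ {I₀} → Solve φ ≡ just I₀ →
              InDerivation ⟨ I₀ , Better I₀ , Better I₀ ∷ [] ⟩
    step    : ∀ {s s'} → InDerivation s → s ⟶ s' → InDerivation s'

-- Invariant: every model of φ that satisfies Δ satisfies some formula on the
-- stack τ. The initial state and F-Sat push Δ itself; F-Split replaces the top
-- ψ by formulas whose disjunction is φ-equivalent to ψ; F-Close pops ψ but
-- conjoins ¬ψ to Δ, so the remaining stack still covers. Hence with τ empty,
-- no model of φ satisfies Δ.
module Submission where

open import Defs
open import Data.List using ([]; _∷_)
open import Data.List.NonEmpty using (_∷_)
open import Data.List.Relation.Unary.Any using (Any; here; there)
open import Data.List.Relation.Unary.Any.Properties using (++⁺ˡ; ++⁺ʳ; ¬Any[])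
open import Data.Empty using (⊥-elim)
open import Data.Product using (_,_)
open import Data.Sum using (inj₁; inj₂)
open import Function.Bundles using (Equivalence)
open import Relation.Binary.PropositionalEquality using (_≡_; refl)

open Equivalence using (to; from)

module Disjunction (T : Theory) where
  open Theory T

  ⊨-⋁′⇒Any : ∀ I ψ ψs → I ⊨ ⋁′ ψ ψs → Any (I ⊨_) (ψ ∷ ψs)
  ⊨-⋁′⇒Any I ψ []       I⊨ = here I⊨
  ⊨-⋁′⇒Any I ψ (χ ∷ χs) I⊨ with to (⊨-∨ I ψ (⋁′ χ χs)) I⊨
  ... | inj₁ I⊨ψ  = here I⊨ψ
  ... | inj₂ I⊨χs = there (⊨-⋁′⇒Any I χ χs I⊨χs)

module Soundness {T : Theory} (GO : GOMT T) (O : Oracles GO) where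
  open Theory T
  open GOMT GO
  open Calculus GO O
  open Disjunction T

  StackCovers : State → Set
  StackCovers s = ∀ J → J ⊨ φ → J ⊨ Δ s → Any (J ⊨_) (τ s)

  ⟶-preserves-StackCovers : ∀ {s s'} → StackCovers s → s ⟶ s' → StackCovers s'
  ⟶-preserves-StackCovers {⟨ _ , _ , ψ ∷ _ ⟩} covers (F-Split (χ ∷ χs) ψ⇔⋁ _) J J⊨φ J⊨Δ
    with covers J J⊨φ J⊨Δ
  ... | here J⊨ψ  = ++⁺ˡ (⊨-⋁′⇒Any J χ χs (to (ψ⇔⋁ J J⊨φ) J⊨ψ))
  ... | there J⊨τ = ++⁺ʳ (χ ∷ χs) J⊨τ
  ⟶-preserves-StackCovers covers (F-Sat _ _) J J⊨φ J⊨Δ = here J⊨Δ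
  ⟶-preserves-StackCovers {⟨ _ , Δ₀ , ψ ∷ _ ⟩} covers (F-Close _ _) J J⊨φ J⊨Δ
    with to (⊨-∧ J Δ₀ (¬ᶠ ψ)) J⊨Δ
  ... | J⊨Δ₀ , J⊨¬ψ with covers J J⊨φ J⊨Δ₀
  ...   | here J⊨ψ  = ⊥-elim (to (⊨-¬ J ψ) J⊨¬ψ J⊨ψ)
  ...   | there J⊨τ = J⊨τ

  InDerivation⇒StackCovers : ∀ {s} → InDerivation s → StackCovers s
  InDerivation⇒StackCovers (initial _) J J⊨φ J⊨Δ = here J⊨Δ
  InDerivation⇒StackCovers (step d r) =
    ⟶-preserves-StackCovers (InDerivation⇒StackCovers d) r

  emptyStack⇒⊨¬Δ : ∀ s → StackCovers s → τ s ≡ [] → φ ⊨ᵀ (¬ᶠ Δ s)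
  emptyStack⇒⊨¬Δ ⟨ _ , Δ₀ , [] ⟩ covers refl J J⊨φ =
    from (⊨-¬ J Δ₀) (λ J⊨Δ → ¬Any[] (covers J J⊨φ J⊨Δ))

corollary1 : {T : Theory} (GO : GOMT T) (O : Oracles GO) →
    Theory.Satisfiable T (GOMT.φ GO) →
    (s : Calculus.State GO O) → Calculus.InDerivation GO O s →
    Calculus.State.τ {GO = GO} {O = O} s ≡ [] →
    Theory._⊨ᵀ_ T (GOMT.φ GO) (Theory.¬ᶠ_ T (Calculus.State.Δ {GO = GO} {O = O} s))
corollary1 GO O _ s d τ≡[] =
  emptyStack⇒⊨¬Δ s (InDerivation⇒StackCovers d) τ≡[]
  where open Soundness GO O
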